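{- Let $M$ be a term and $n\in\mathbb{N}$, $\mathbb{A}\in\mathscr{A}$. If $\vdash M:\mathbb{A}^n$ is derivable (empty context) in the unrestricted type system, then $M$ has a unique normal form with respect to $\leadsto$, and this normal form is a free algebra term $t$ (i.e. an element of $\mathscr{E}_\mathscr{A}$).
   Context: Free algebras: a free algebra $\mathbb{A}=(\mathcal{C}_\mathbb{A},\mathcal{R}_\mathbb{A})$ consists of a finite set of constructors $\mathcal{C}_\mathbb{A}=\{c^\mathbb{A}_1,\dots,c^\mathbb{A}_{k(\mathbb{A})}\}$ and an arity map $\mathcal{R}_\mathbb{A}:\mathcal{C}_\mathbb{A}\to\mathbb{N}$. $\mathscr{A}$ is a fixed finite family of free algebras with pairwise disjoint constructor sets. $\mathscr{E}_\mathbb{A}$ is the set of closed terms built from constructors of $\mathbb{A}$ respecting arities (written $c\,t_1\cdots t_{\mathcal{R}(c)}$), and $\mathscr{E}_\mathscr{A}=\bigcup_{\mathbb{A}\in\mathscr{A}}\mathscr{E}_\mathbb{A}$; these are the free algebra terms. Terms: $M::=x\mid c\mid MM\mid \lambda x.M\mid M\{\!\{M,\dots,M\}\!\}\mid M\langle\!\langle M,\dots,M\rangle\!\rangle$ ($c$ any constructor; the last two are conditional and recursion, with one branch per constructor of the algebra). Types: $A::=\mathbb{A}^n\mid A\multimap A$ with $n\in\mathbb{N}$, $\mathbb{A}\in\mathscr{A}$. $A\multimap^0B=B$, $A\multimap^{n+1}B=A\multimap(A\multimap^nB)$. Typing rules (contexts are finite maps variables $\to$ types; $\Gamma,\Delta$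 disjoint union): (A) $x:A\vdash x:A$; (W) from $\Gamma\vdash M:B$ infer $\Gamma,x:A\vdash M:B$; (C) from $\Gamma,x:A,y:A\vdash M:B$ infer $\Gamma,z:A\vdash M\{z/x,z/y\}:B$; ($I_\multimap$) from $\Gamma,x:A\vdash M:B$ infer $\Gamma\vdash\lambda x.M:A\multimap B$; ($E_\multimap$) from $\Gamma\vdash M:A\multimap B$ and $\Delta\vdash N:A$ infer $\Gamma,\Delta\vdash MN:B$; ($I_\mathbb{A}$) $\vdash c:\mathbb{A}^n\multimap^{\mathcal{R}(c)}\mathbb{A}^n$ for every $n$ and $c\in\mathcal{C}_\mathbb{A}$; ($E^C_\mathbb{A}$) from $\Gamma_i\vdash M_{c^\mathbb{A}_i}:\mathbb{A}^m\multimap^{\mathcal{R}(c^\mathbb{A}_i)}C$ ($i=1..k(\mathbb{A})$) and $\Delta\vdash L:\mathbb{A}^m$ infer $\Gamma_1,\dots,\Gamma_{k(\mathbb{A})},\Delta\vdash L\{\!\{M_{c_1^\mathbb{A}},\dots,M_{c^\mathbb{A}_{k(\mathbb{A})}}\}\!\}:C$; ($E^R_\mathbb{A}$) from $\Gamma_i\vdash M_{c^\mathbb{A}_i}:\mathbb{A}^m\multimap^{\mathcal{R}(c^\mathbb{A}_i)}(C\multimap^{\mathcal{R}(c^\mathbb{A}_i)}C)$ and $\Delta\vdash L:\mathbb{A}^m$ infer $\Gamma_1,\dots,\Gamma_{k(\mathbb{A})},\Delta\vdash L\langle\!\langle M_{c_1^\mathbb{A}},\dots,M_{c^\mathbb{A}_{k(\mathbb{A})}}\rangle\!\rangle:C$.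 The unrestricted system uses these rules with no further constraints. Values: $V::=x\mid\lambda x.M\mid T$, $T::=c\mid TT$. Reduction $\to$: $(\lambda x.M)V\to M\{V/x\}$; $c_i^\mathbb{A}t_1\cdots t_r\{\!\{M_{c_1},\dots,M_{c_k}\}\!\}\to M_{c_i}t_1\cdots t_r$; $c_i^\mathbb{A}t_1\cdots t_r\langle\!\langle M_{c_1},\dots,M_{c_k}\rangle\!\rangle\to M_{c_i}t_1\cdots t_r(t_1\langle\!\langle M_{c_1},\dots,M_{c_k}\rangle\!\rangle)\cdots(t_r\langle\!\langle M_{c_1},\dots,M_{c_k}\rangle\!\rangle)$, where $r=\mathcal{R}(c_i^\mathbb{A})$ and $t_j$ are free algebra terms. Weak reduction $\leadsto$ is the smallest relation containing $\to$ and closed under: $M\leadsto N$ implies $ML\leadsto NL$, $LM\leadsto LN$, $M\{\!\{\vec L\}\!\}\leadsto N\{\!\{\vec L\}\!\}$, $M\langle\!\langle\vec L\rangle\!\rangle\leadsto N\langle\!\langle\vec L\rangle\!\rangle$ (no reduction under $\lambda$ or inside branches). -}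

module Defs where

open import Data.Nat using (ℕ; zero; suc; _+_)
open import Data.Fin using (Fin; toℕ; cast)
open import Data.List using (List; []; _∷_; _++_; length; map; foldl; lookup; tabulate)
open import Data.List.Relation.Unary.All using (All)
open import Data.Product using (Σ; ∃; _×_; _,_)
open import Relation.Binary.PropositionalEquality using (_≡_; sym)
open import Relation.Binary.Construct.Closure.ReflexiveTransitive using (Star)
open import Relation.Nullary using (¬_)

-- Constructors are the
-- pairs (a , i), so constructor sets of distinct algebras are disjoint.
record Signature : Set where
  field
    nAlg  : ℕ
    nCon  : Fin nAlg → ℕ
    arity : (a : Fin nAlg) → Fin (nCon a) → ℕ

module Lang (S : Signature) where
  open Signature S

  -- Terms, with de Bruijn indices for variables.
  -- case L Ms  is  L{{M_1,…,M_k}},   rec L Ms  is  L<<M_1,…,M_k>>.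
  data Term : Set where
    var  : ℕ → Term
    con  : (a : Fin nAlg) → Fin (nCon a) → Term
    app  : Term → Term → Term
    lam  : Term → Term
    case : Term → List Term → Term
    rec  : Term → List Term → Term

  apps : Term → List Term → Term
  apps = foldl app

  infixr 5 _⊸_
  data Ty : Set where
    base : Fin nAlg → ℕ → Ty
    _⊸_  : Ty → Ty → Ty

  _⊸^_∙_ : Ty → ℕ → Ty → Ty
  A ⊸^ zero  ∙ B = B
  A ⊸^ suc n ∙ B = A ⊸ (A ⊸^ n ∙ B)

  ext : (ℕ → ℕ) → ℕ → ℕ
  ext ρ zero    = zero
  ext ρ (suc x) = suc (ρ x)

  mutual
    rename : (ℕ → ℕ) → Term → Term
    rename ρ (var x)     = var (ρ x)
    rename ρ (con a i)   = con a i
    rename ρ (app M N)   = app (rename ρ M) (rename ρ N)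
    rename ρ (lam M)     = lam (rename (ext ρ) M)
    rename ρ (case L Ms) = case (rename ρ L) (renames ρ Ms)
    rename ρ (rec L Ms)  = rec (rename ρ L) (renames ρ Ms)

    renames : (ℕ → ℕ) → List Term → List Term
    renames ρ []       = []
    renames ρ (M ∷ Ms) = rename ρ M ∷ renames ρ Ms

  shift : ℕ → Term → Term
  shift k = rename (k +_)

  exts : (ℕ → Term) → ℕ → Term
  exts σ zero    = var zero
  exts σ (suc x) = rename suc (σ x)

  mutual
    sub : (ℕ → Term) → Term → Term
    sub σ (var x)     = σ x
    sub σ (con a i)   = con a i
    sub σ (app M N)   = app (sub σ M) (sub σ N)
    sub σ (lam M)     = lam (sub (exts σ) M)
    sub σ (case L Ms) = case (sub σ L) (subs σ Ms)
    sub σ (rec L Ms)  = rec (sub σ L) (subs σ Ms)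

    subs : (ℕ → Term) → List Term → List Term
    subs σ []       = []
    subs σ (M ∷ Ms) = sub σ M ∷ subs σ Ms

  sub0 : Term → ℕ → Term
  sub0 V zero    = V
  sub0 V (suc x) = var x

  _[_] : Term → Term → Term
  M [ V ] = sub (sub0 V) M

  data FAT (a : Fin nAlg) : Term → Set where
    fat : (i : Fin (nCon a)) (ts : List Term) →
          length ts ≡ arity a i → All (FAT a) ts → FAT a (apps (con a i) ts)

  FreeAlgTerm : Term → Set
  FreeAlgTerm t = Σ (Fin nAlg) λ a → FAT a t

  data IsT : Term → Set where
    tcon : ∀ a i → IsT (con a i)
    tapp : ∀ {T U} → IsT T → IsT U → IsT (app T U)

  data Value : Term → Set where
    vvar : ∀ x → Value (var x)
    vlam : ∀ M → Value (lam M)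
    vT   : ∀ {T} → IsT T → Value T

  -- Contexts are lists of types; de Bruijn index j refers to the
  -- j-th entry.  Disjoint union Γ,Δ is Γ ++ Δ (the terms typed in Δ are
  -- shifted accordingly).  Weakening, contraction (and exchange, implicit in
  -- the paper since contexts are finite maps) are combined into one
  -- structural renaming rule.
  Structural : List Ty → List Ty → (ℕ → ℕ) → Set
  Structural Γ Δ ρ = (i : Fin (length Γ)) →
    Σ (Fin (length Δ)) λ j → (toℕ j ≡ ρ (toℕ i)) × (lookup Δ j ≡ lookup Γ i)

  caseBranchTys : Fin nAlg → ℕ → Ty → List Ty
  caseBranchTys a m C = tabulate λ i → base a m ⊸^ arity a i ∙ C

  recBranchTys : Fin nAlg → ℕ → Ty → List Ty
  recBranchTys a m C = tabulate λ i → base a m ⊸^ arity a i ∙ (C ⊸^ arity a i ∙ C)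

  infix 4 _⊢_∶_ _⊢*_∶_
  mutual
    data _⊢_∶_ : List Ty → Term → Ty → Set where
      ax   : ∀ {A} → (A ∷ []) ⊢ var zero ∶ A
      str  : ∀ {Γ Δ M B} (ρ : ℕ → ℕ) → Structural Γ Δ ρ →
             Γ ⊢ M ∶ B → Δ ⊢ rename ρ M ∶ B
      ⊸I   : ∀ {Γ A M B} → (A ∷ Γ) ⊢ M ∶ B → Γ ⊢ lam M ∶ A ⊸ B
      ⊸E   : ∀ {Γ Δ M N A B} → Γ ⊢ M ∶ A ⊸ B → Δ ⊢ N ∶ A →
             (Γ ++ Δ) ⊢ app M (shift (length Γ) N) ∶ B
      algI : ∀ {n} a i → [] ⊢ con a i ∶ (base a n ⊸^ arity a i ∙ base a n)
      algEC : ∀ {Δ Γ L Ms a m C} → Δ ⊢ L ∶ base a m →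
              Γ ⊢* Ms ∶ caseBranchTys a m C →
              (Δ ++ Γ) ⊢ case L (renames (length Δ +_) Ms) ∶ C
      algER : ∀ {Δ Γ L Ms a m C} → Δ ⊢ L ∶ base a m →
              Γ ⊢* Ms ∶ recBranchTys a m C →
              (Δ ++ Γ) ⊢ rec L (renames (length Δ +_) Ms) ∶ C

    data _⊢*_∶_ : List Ty → List Term → List Ty → Set where
      []  : [] ⊢* [] ∶ []
      _∷_ : ∀ {Γ Δ M Ms A As} → Γ ⊢ M ∶ A → Δ ⊢* Ms ∶ As →
            (Γ ++ Δ) ⊢* (M ∷ renames (length Γ +_) Ms) ∶ (A ∷ As)

  infix 4 _⟶_ _⇝_ _⇝*_
  data _⟶_ : Term → Term → Set where
    β    : ∀ {M V} → Value V → app (lam M) V ⟶ M [ V ]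
    ιcase : ∀ {a i ts Ms} → length ts ≡ arity a i → All FreeAlgTerm ts →
            (eq : length Ms ≡ nCon a) →
            case (apps (con a i) ts) Ms ⟶ apps (lookup Ms (cast (sym eq) i)) ts
    ιrec : ∀ {a i ts Ms} → length ts ≡ arity a i → All FreeAlgTerm ts →
           (eq : length Ms ≡ nCon a) →
           rec (apps (con a i) ts) Ms ⟶
             apps (apps (lookup Ms (cast (sym eq) i)) ts) (map (λ t → rec t Ms) ts)

  data _⇝_ : Term → Term → Set where
    top   : ∀ {M N} → M ⟶ N → M ⇝ N
    appL  : ∀ {M N L} → M ⇝ N → app M L ⇝ app N L
    appR  : ∀ {M N L} → M ⇝ N → app L M ⇝ app L N
    caseL : ∀ {M N Ls} → M ⇝ N → case M Ls ⇝ case N Ls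
    recL  : ∀ {M N Ls} → M ⇝ N → rec M Ls ⇝ rec N Ls

  _⇝*_ : Term → Term → Set
  _⇝*_ = Star _⇝_

  Normal : Term → Set
  Normal M = ¬ (∃ λ N → M ⇝ N)

  UniqueNormalForm : Term → Term → Set
  UniqueNormalForm M N =
    (M ⇝* N) × Normal N × (∀ N' → M ⇝* N' → Normal N' → N' ≡ N)

{-# OPTIONS --safe #-}
module Submission where

open import Defs
open import Data.Nat using (ℕ; zero; suc; _+_; pred)
open import Data.Nat.Properties using (+-suc; +-identityʳ)
open import Data.Fin using (Fin; toℕ; cast; zero; suc)
open import Data.List using (List; []; _∷_; _++_; _∷ʳ_; length; map; lookup; tabulate)
open import Data.List.Properties using (++-assoc; ++-identityʳ; foldl-∷ʳ; length-map; length-++-comm; length-tabulate)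
open import Data.List.Relation.Unary.All as All using (All; []; _∷_)
open import Data.List.Relation.Unary.All.Properties using (∷ʳ⁺)
open import Data.List.Relation.Binary.Pointwise using (Pointwise; []; _∷_; Pointwise-length)
open import Data.Product using (Σ; ∃; _×_; _,_; proj₂)
open import Data.Sum using (_⊎_; inj₁; inj₂)
open import Data.Empty using (⊥-elim)
open import Data.Unit using (⊤; tt)
open import Function using (_∘_)
open import Relation.Binary.PropositionalEquality
  using (_≡_; refl; sym; trans; cong; cong₂; subst; subst₂; _≗_)
open import Relation.Binary.Construct.Closure.ReflexiveTransitive using (ε; _◅_; _◅◅_; gmap)
open import Relation.Nullary using (¬_)

-- A value is reducible at 𝔸^n when it is a free algebra term,
-- and at A ⊸ B when applied to any reducible value it reduces to a reducible
-- value; every typed term under a reducible substitution reduces to a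
-- reducible value.  Free algebra terms are reducible at every 𝔸^n, which makes
-- the ι-rules of case and rec reducible (rec by induction on the scrutinee).
-- Weak reduction never fires inside a redex, whose immediate subterms are
-- values, so two distinct one-step reducts are joined in one step each; this
-- diamond property makes the normal form unique.

Pointwise-tabulate-length : ∀ {A B : Set} {R : A → B → Set} {n} {f : Fin n → A} {ys} →
                            Pointwise R (tabulate f) ys → length ys ≡ n
Pointwise-tabulate-length {f = f} rs = trans (sym (Pointwise-length rs)) (length-tabulate f)

Pointwise-lookup-tabulate : ∀ {A B : Set} {R : A → B → Set} {n} (f : Fin n → A) {ys} →
                            Pointwise R (tabulate f) ys → .(p : n ≡ length ys) →
                            ∀ i → R (f i) (lookup ys (cast p i))
Pointwise-lookup-tabulate f (r ∷ rs) p zero    = r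
Pointwise-lookup-tabulate f (r ∷ rs) p (suc i) =
  Pointwise-lookup-tabulate (f ∘ suc) rs (cong pred p) i

module WeakNormalisation (S : Signature) where
  open Signature S
  open Lang S

  -- Substitution

  ext-cong : ∀ {ρ ρ′} → ρ ≗ ρ′ → ext ρ ≗ ext ρ′
  ext-cong e zero    = refl
  ext-cong e (suc x) = cong suc (e x)

  exts-cong : ∀ {σ τ} → σ ≗ τ → exts σ ≗ exts τ
  exts-cong e zero    = refl
  exts-cong e (suc x) = cong (rename suc) (e x)

  mutual
    rename-cong : ∀ {ρ ρ′} → ρ ≗ ρ′ → ∀ M → rename ρ M ≡ rename ρ′ M
    rename-cong e (var x)     = cong var (e x)
    rename-cong e (con a i)   = refl
    rename-cong e (app M N)   = cong₂ app (rename-cong e M) (rename-cong e N)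
    rename-cong e (lam M)     = cong lam (rename-cong (ext-cong e) M)
    rename-cong e (case L Ms) = cong₂ case (rename-cong e L) (renames-cong e Ms)
    rename-cong e (rec L Ms)  = cong₂ rec (rename-cong e L) (renames-cong e Ms)

    renames-cong : ∀ {ρ ρ′} → ρ ≗ ρ′ → ∀ Ms → renames ρ Ms ≡ renames ρ′ Ms
    renames-cong e []       = refl
    renames-cong e (M ∷ Ms) = cong₂ _∷_ (rename-cong e M) (renames-cong e Ms)

  mutual
    sub-cong : ∀ {σ τ} → σ ≗ τ → ∀ M → sub σ M ≡ sub τ M
    sub-cong e (var x)     = e x
    sub-cong e (con a i)   = refl
    sub-cong e (app M N)   = cong₂ app (sub-cong e M) (sub-cong e N)
    sub-cong e (lam M)     = cong lam (sub-cong (exts-cong e) M)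
    sub-cong e (case L Ms) = cong₂ case (sub-cong e L) (subs-cong e Ms)
    sub-cong e (rec L Ms)  = cong₂ rec (sub-cong e L) (subs-cong e Ms)

    subs-cong : ∀ {σ τ} → σ ≗ τ → ∀ Ms → subs σ Ms ≡ subs τ Ms
    subs-cong e []       = refl
    subs-cong e (M ∷ Ms) = cong₂ _∷_ (sub-cong e M) (subs-cong e Ms)

  ext-∘ : ∀ ρ ρ′ → ext ρ ∘ ext ρ′ ≗ ext (ρ ∘ ρ′)
  ext-∘ ρ ρ′ zero    = refl
  ext-∘ ρ ρ′ (suc x) = refl

  mutual
    rename-rename : ∀ ρ ρ′ M → rename ρ (rename ρ′ M) ≡ rename (ρ ∘ ρ′) M
    rename-rename ρ ρ′ (var x)     = refl
    rename-rename ρ ρ′ (con a i)   = refl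
    rename-rename ρ ρ′ (app M N)   = cong₂ app (rename-rename ρ ρ′ M) (rename-rename ρ ρ′ N)
    rename-rename ρ ρ′ (lam M)     =
      cong lam (trans (rename-rename (ext ρ) (ext ρ′) M) (rename-cong (ext-∘ ρ ρ′) M))
    rename-rename ρ ρ′ (case L Ms) = cong₂ case (rename-rename ρ ρ′ L) (renames-renames ρ ρ′ Ms)
    rename-rename ρ ρ′ (rec L Ms)  = cong₂ rec (rename-rename ρ ρ′ L) (renames-renames ρ ρ′ Ms)

    renames-renames : ∀ ρ ρ′ Ms → renames ρ (renames ρ′ Ms) ≡ renames (ρ ∘ ρ′) Ms
    renames-renames ρ ρ′ []       = refl
    renames-renames ρ ρ′ (M ∷ Ms) = cong₂ _∷_ (rename-rename ρ ρ′ M) (renames-renames ρ ρ′ Ms)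

  exts-ext : ∀ τ ρ → exts τ ∘ ext ρ ≗ exts (τ ∘ ρ)
  exts-ext τ ρ zero    = refl
  exts-ext τ ρ (suc x) = refl

  mutual
    sub-rename : ∀ τ ρ M → sub τ (rename ρ M) ≡ sub (τ ∘ ρ) M
    sub-rename τ ρ (var x)     = refl
    sub-rename τ ρ (con a i)   = refl
    sub-rename τ ρ (app M N)   = cong₂ app (sub-rename τ ρ M) (sub-rename τ ρ N)
    sub-rename τ ρ (lam M)     =
      cong lam (trans (sub-rename (exts τ) (ext ρ) M) (sub-cong (exts-ext τ ρ) M))
    sub-rename τ ρ (case L Ms) = cong₂ case (sub-rename τ ρ L) (subs-renames τ ρ Ms)
    sub-rename τ ρ (rec L Ms)  = cong₂ rec (sub-rename τ ρ L) (subs-renames τ ρ Ms)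

    subs-renames : ∀ τ ρ Ms → subs τ (renames ρ Ms) ≡ subs (τ ∘ ρ) Ms
    subs-renames τ ρ []       = refl
    subs-renames τ ρ (M ∷ Ms) = cong₂ _∷_ (sub-rename τ ρ M) (subs-renames τ ρ Ms)

  ext-exts : ∀ ρ τ → rename (ext ρ) ∘ exts τ ≗ exts (rename ρ ∘ τ)
  ext-exts ρ τ zero    = refl
  ext-exts ρ τ (suc x) = trans (rename-rename (ext ρ) suc (τ x)) (sym (rename-rename suc ρ (τ x)))

  mutual
    rename-sub : ∀ ρ τ M → rename ρ (sub τ M) ≡ sub (rename ρ ∘ τ) M
    rename-sub ρ τ (var x)     = refl
    rename-sub ρ τ (con a i)   = refl
    rename-sub ρ τ (app M N)   = cong₂ app (rename-sub ρ τ M) (rename-sub ρ τ N)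
    rename-sub ρ τ (lam M)     =
      cong lam (trans (rename-sub (ext ρ) (exts τ) M) (sub-cong (ext-exts ρ τ) M))
    rename-sub ρ τ (case L Ms) = cong₂ case (rename-sub ρ τ L) (renames-subs ρ τ Ms)
    rename-sub ρ τ (rec L Ms)  = cong₂ rec (rename-sub ρ τ L) (renames-subs ρ τ Ms)

    renames-subs : ∀ ρ τ Ms → renames ρ (subs τ Ms) ≡ subs (rename ρ ∘ τ) Ms
    renames-subs ρ τ []       = refl
    renames-subs ρ τ (M ∷ Ms) = cong₂ _∷_ (rename-sub ρ τ M) (renames-subs ρ τ Ms)

  exts-exts : ∀ τ σ → sub (exts τ) ∘ exts σ ≗ exts (sub τ ∘ σ)
  exts-exts τ σ zero    = refl
  exts-exts τ σ (suc x) = trans (sub-rename (exts τ) suc (σ x)) (sym (rename-sub suc τ (σ x)))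

  mutual
    sub-sub : ∀ τ σ M → sub τ (sub σ M) ≡ sub (sub τ ∘ σ) M
    sub-sub τ σ (var x)     = refl
    sub-sub τ σ (con a i)   = refl
    sub-sub τ σ (app M N)   = cong₂ app (sub-sub τ σ M) (sub-sub τ σ N)
    sub-sub τ σ (lam M)     =
      cong lam (trans (sub-sub (exts τ) (exts σ) M) (sub-cong (exts-exts τ σ) M))
    sub-sub τ σ (case L Ms) = cong₂ case (sub-sub τ σ L) (subs-subs τ σ Ms)
    sub-sub τ σ (rec L Ms)  = cong₂ rec (sub-sub τ σ L) (subs-subs τ σ Ms)

    subs-subs : ∀ τ σ Ms → subs τ (subs σ Ms) ≡ subs (sub τ ∘ σ) Ms
    subs-subs τ σ []       = refl
    subs-subs τ σ (M ∷ Ms) = cong₂ _∷_ (sub-sub τ σ M) (subs-subs τ σ Ms)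

  exts-var : exts var ≗ var
  exts-var zero    = refl
  exts-var (suc x) = refl

  mutual
    sub-var : ∀ M → sub var M ≡ M
    sub-var (var x)     = refl
    sub-var (con a i)   = refl
    sub-var (app M N)   = cong₂ app (sub-var M) (sub-var N)
    sub-var (lam M)     = cong lam (trans (sub-cong exts-var M) (sub-var M))
    sub-var (case L Ms) = cong₂ case (sub-var L) (subs-var Ms)
    sub-var (rec L Ms)  = cong₂ rec (sub-var L) (subs-var Ms)

    subs-var : ∀ Ms → subs var Ms ≡ Ms
    subs-var []       = refl
    subs-var (M ∷ Ms) = cong₂ _∷_ (sub-var M) (subs-var Ms)

  infixr 5 _•_
  _•_ : Term → (ℕ → Term) → ℕ → Term
  (W • σ) zero    = W
  (W • σ) (suc x) = σ x

  exts-[] : ∀ W σ M → sub (exts σ) M [ W ] ≡ sub (W • σ) M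
  exts-[] W σ M = trans (sub-sub (sub0 W) (exts σ) M) (sub-cong sub0-exts M)
    where
    sub0-exts : sub (sub0 W) ∘ exts σ ≗ W • σ
    sub0-exts zero    = refl
    sub0-exts (suc x) = trans (sub-rename (sub0 W) suc (σ x)) (sub-var (σ x))

  apps-IsT : ∀ {T} Ts → IsT T → All IsT Ts → IsT (apps T Ts)
  apps-IsT []       T []       = T
  apps-IsT (_ ∷ Ts) T (U ∷ Us) = apps-IsT Ts (tapp T U) Us

  mutual
    FAT⇒IsT : ∀ {a t} → FAT a t → IsT t
    FAT⇒IsT (fat i ts _ ps) = apps-IsT ts (tcon _ i) (All-FAT⇒IsT ps)

    All-FAT⇒IsT : ∀ {a ts} → All (FAT a) ts → All IsT ts
    All-FAT⇒IsT []       = []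
    All-FAT⇒IsT (p ∷ ps) = FAT⇒IsT p ∷ All-FAT⇒IsT ps

  IsT-irreducible : ∀ {T N} → IsT T → ¬ (T ⇝ N)
  IsT-irreducible (tcon a i)  (top ())
  IsT-irreducible (tapp () _) (top (β _))
  IsT-irreducible (tapp T _)  (appL s) = IsT-irreducible T s
  IsT-irreducible (tapp _ U)  (appR s) = IsT-irreducible U s

  value-irreducible : ∀ {V N} → Value V → ¬ (V ⇝ N)
  value-irreducible (vvar x) (top ())
  value-irreducible (vlam M) (top ())
  value-irreducible (vT T)   s = IsT-irreducible T s

  FAT-normal : ∀ {a t} → FAT a t → Normal t
  FAT-normal t∈𝔸 (_ , s) = IsT-irreducible (FAT⇒IsT t∈𝔸) s

  -- Reducibility

  mutual
    RedVal : Ty → Term → Set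
    RedVal (base a n) V = FAT a V
    RedVal (A ⊸ B)    V = Value V × (∀ W → RedVal A W → Red B (app V W))

    Red : Ty → Term → Set
    Red A M = ∃ λ V → M ⇝* V × RedVal A V

  RedVal⇒Value : ∀ A {V} → RedVal A V → Value V
  RedVal⇒Value (base a n) t∈𝔸     = vT (FAT⇒IsT t∈𝔸)
  RedVal⇒Value (A ⊸ B)    (V , _) = V

  Red-expand : ∀ {A M M′} → M ⇝* M′ → Red A M′ → Red A M
  Red-expand M⇝*M′ (V , M′⇝*V , v) = V , M⇝*M′ ◅◅ M′⇝*V , v

  Red-app : ∀ {A B M N} → Red (A ⊸ B) M → Red A N → Red B (app M N)
  Red-app (V , M⇝*V , _ , f) (W , N⇝*W , w) =
    Red-expand (gmap _ appL M⇝*V ◅◅ gmap _ appR N⇝*W) (f W w)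

  Red-apps : ∀ {A C r M} Ns → Red (A ⊸^ r ∙ C) M → All (Red A) Ns → length Ns ≡ r →
             Red C (apps M Ns)
  Red-apps []       m []       refl = m
  Red-apps (N ∷ Ns) m (n ∷ ns) refl = Red-apps Ns (Red-app m n) ns refl

  con-RedVal : ∀ {a i n} r ts → All (FAT a) ts → r + length ts ≡ arity a i →
               RedVal (base a n ⊸^ r ∙ base a n) (apps (con a i) ts)
  con-RedVal {i = i} zero    ts ps e = fat i ts e ps
  con-RedVal {a} {i} (suc r) ts ps e =
    vT (apps-IsT ts (tcon a i) (All-FAT⇒IsT ps)) ,
    λ W w → _ , ε ,
      subst (RedVal _) (foldl-∷ʳ app (con a i) W ts)
        (con-RedVal r (ts ∷ʳ W) (∷ʳ⁺ ps w)
          (trans (cong (r +_) (length-++-comm ts (W ∷ []))) (trans (+-suc r _) e)))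

  Red-con : ∀ {n} a i → Red (base a n ⊸^ arity a i ∙ base a n) (con a i)
  Red-con a i = _ , ε , con-RedVal (arity a i) [] [] (+-identityʳ _)

  Red-FAT : ∀ {a m t} → FAT a t → Red (base a m) t
  Red-FAT t∈𝔸 = _ , ε , t∈𝔸

  Red-case : ∀ {a m C t Ms} → FAT a t → Pointwise Red (caseBranchTys a m C) Ms →
             Red C (case t Ms)
  Red-case {a} {m} (fat i ts |ts| ps) bs =
    Red-expand (top (ιcase |ts| (All.map (a ,_) ps) |Ms|) ◅ ε)
      (Red-apps ts (Pointwise-lookup-tabulate _ bs (sym |Ms|) i) (All.map (Red-FAT {m = m}) ps) |ts|)
    where |Ms| = Pointwise-tabulate-length bs

  mutual
    Red-rec : ∀ {a m C t Ms} → FAT a t → Pointwise Red (recBranchTys a m C) Ms →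
              Red C (rec t Ms)
    Red-rec {a} {m} (fat i ts |ts| ps) bs =
      Red-expand (top (ιrec |ts| (All.map (a ,_) ps) |Ms|) ◅ ε)
        (Red-apps (map (λ t → rec t _) ts)
          (Red-apps ts (Pointwise-lookup-tabulate _ bs (sym |Ms|) i) (All.map (Red-FAT {m = m}) ps) |ts|)
          (All-Red-rec ps bs) (trans (length-map _ ts) |ts|))
      where |Ms| = Pointwise-tabulate-length bs

    All-Red-rec : ∀ {a m C ts Ms} → All (FAT a) ts → Pointwise Red (recBranchTys a m C) Ms →
                  All (Red C) (map (λ t → rec t Ms) ts)
    All-Red-rec []       bs = []
    All-Red-rec (p ∷ ps) bs = Red-rec p bs ∷ All-Red-rec ps bs

  RedSub : List Ty → (ℕ → Term) → Set
  RedSub []      σ = ⊤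
  RedSub (A ∷ Γ) σ = RedVal A (σ zero) × RedSub Γ (σ ∘ suc)

  RedSub-++ : ∀ Γ {Δ σ} → RedSub (Γ ++ Δ) σ → RedSub Γ σ × RedSub Δ (σ ∘ (length Γ +_))
  RedSub-++ []      g       = tt , g
  RedSub-++ (A ∷ Γ) (v , g) with RedSub-++ Γ g
  ... | gΓ , gΔ = (v , gΓ) , gΔ

  RedSub-lookup : ∀ {Γ σ} → RedSub Γ σ → ∀ i → RedVal (lookup Γ i) (σ (toℕ i))
  RedSub-lookup {_ ∷ _} (v , g) zero    = v
  RedSub-lookup {_ ∷ _} (v , g) (suc i) = RedSub-lookup g i

  RedSub-tabulate : ∀ Γ {σ} → (∀ i → RedVal (lookup Γ i) (σ (toℕ i))) → RedSub Γ σ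
  RedSub-tabulate []      g = tt
  RedSub-tabulate (A ∷ Γ) g = g zero , RedSub-tabulate Γ (g ∘ suc)

  RedSub-structural : ∀ {Γ Δ ρ σ} → Structural Γ Δ ρ → RedSub Δ σ → RedSub Γ (σ ∘ ρ)
  RedSub-structural {Γ} {Δ} {ρ} {σ} s g = RedSub-tabulate Γ λ i → renamed (s i)
    where
    renamed : ∀ {i} → (Σ (Fin (length Δ)) λ j → (toℕ j ≡ ρ (toℕ i)) × (lookup Δ j ≡ lookup Γ i)) →
              RedVal (lookup Γ i) (σ (ρ (toℕ i)))
    renamed (j , j≡ρi , Δj≡Γi) =
      subst₂ RedVal Δj≡Γi (cong σ j≡ρi) (RedSub-lookup g j)

  mutual
    fundamental : ∀ {Γ M A σ} → Γ ⊢ M ∶ A → RedSub Γ σ → Red A (sub σ M)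
    fundamental ax           (v , tt) = _ , ε , v
    fundamental (str ρ s ⊢M) g        = fundamental-rename ⊢M (RedSub-structural s g)
    fundamental {σ = σ} (⊸I {A = A} {M} ⊢M) g =
      _ , ε , vlam _ , λ W w →
        Red-expand (top (β (RedVal⇒Value A w)) ◅ ε)
          (subst (Red _) (sym (exts-[] W σ M)) (fundamental ⊢M (w , g)))
    fundamental (⊸E {Γ} ⊢M ⊢N) g with RedSub-++ Γ g
    ... | gΓ , gΔ = Red-app (fundamental ⊢M gΓ) (fundamental-rename ⊢N gΔ)
    fundamental (algI a i) g = Red-con a i
    fundamental (algEC {Δ} ⊢L ⊢Ms) g with RedSub-++ Δ g
    ... | gΔ , gΓ with fundamental ⊢L gΔ
    ...   | t , L⇝*t , t∈𝔸 =
      Red-expand (gmap _ caseL L⇝*t) (Red-case t∈𝔸 (fundamentals-rename ⊢Ms gΓ))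
    fundamental (algER {Δ} ⊢L ⊢Ms) g with RedSub-++ Δ g
    ... | gΔ , gΓ with fundamental ⊢L gΔ
    ...   | t , L⇝*t , t∈𝔸 =
      Red-expand (gmap _ recL L⇝*t) (Red-rec t∈𝔸 (fundamentals-rename ⊢Ms gΓ))

    fundamental-rename : ∀ {Γ M A σ ρ} → Γ ⊢ M ∶ A → RedSub Γ (σ ∘ ρ) →
                         Red A (sub σ (rename ρ M))
    fundamental-rename {M = M} {σ = σ} {ρ} ⊢M g =
      subst (Red _) (sym (sub-rename σ ρ M)) (fundamental ⊢M g)

    fundamentals : ∀ {Γ Ms As σ} → Γ ⊢* Ms ∶ As → RedSub Γ σ → Pointwise Red As (subs σ Ms)
    fundamentals [] g = []
    fundamentals (_∷_ {Γ} ⊢M ⊢Ms) g with RedSub-++ Γ g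
    ... | gΓ , gΔ = fundamental ⊢M gΓ ∷ fundamentals-rename ⊢Ms gΔ

    fundamentals-rename : ∀ {Γ Ms As σ ρ} → Γ ⊢* Ms ∶ As → RedSub Γ (σ ∘ ρ) →
                          Pointwise Red As (subs σ (renames ρ Ms))
    fundamentals-rename {Ms = Ms} {σ = σ} {ρ} ⊢Ms g =
      subst (Pointwise Red _) (sym (subs-renames σ ρ Ms)) (fundamentals ⊢Ms g)

  closed-normalises : ∀ {M a n} → [] ⊢ M ∶ base a n → ∃ λ t → M ⇝* t × FAT a t
  closed-normalises {M} {a} {n} ⊢M = subst (Red (base a n)) (sub-var M) (fundamental ⊢M tt)

  -- Uniqueness of weak normal forms

  head : Term → Term
  head (app M _) = head M
  head M         = M

  spine : Term → List Term
  spine (app M N) = spine M ∷ʳ N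
  spine _         = []

  head-apps : ∀ M Ns → head (apps M Ns) ≡ head M
  head-apps M []       = refl
  head-apps M (N ∷ Ns) = head-apps (app M N) Ns

  spine-apps : ∀ M Ns → spine (apps M Ns) ≡ spine M ++ Ns
  spine-apps M []       = sym (++-identityʳ (spine M))
  spine-apps M (N ∷ Ns) = trans (spine-apps (app M N) Ns) (++-assoc (spine M) (N ∷ []) Ns)

  apps-con-injective : ∀ {a i ts a′ i′ ts′} → apps (con a i) ts ≡ apps (con a′ i′) ts′ →
                       con a i ≡ con a′ i′ × ts ≡ ts′
  apps-con-injective {a} {i} {ts} {a′} {i′} {ts′} eq =
    trans (sym (head-apps (con a i) ts)) (trans (cong head eq) (head-apps (con a′ i′) ts′)) ,
    trans (sym (spine-apps (con a i) ts)) (trans (cong spine eq) (spine-apps (con a′ i′) ts′))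

  case-injective : ∀ {L Ms L′ Ms′} → case L Ms ≡ case L′ Ms′ → L ≡ L′ × Ms ≡ Ms′
  case-injective refl = refl , refl

  rec-injective : ∀ {L Ms L′ Ms′} → rec L Ms ≡ rec L′ Ms′ → L ≡ L′ × Ms ≡ Ms′
  rec-injective refl = refl , refl

  -- The redex is given up to an equation, since unifying two ι-redexes
  -- would get stuck on apps.
  ⟶-deterministic : ∀ {M M′ N N′} → M ⟶ N → M′ ⟶ N′ → M ≡ M′ → N ≡ N′
  ⟶-deterministic (β _) (β _) refl = refl
  ⟶-deterministic (ιcase {a} {i} {ts} _ _ _) (ιcase {a′} {i′} {ts′} _ _ _) eq
    with case-injective eq
  ... | L≡L′ , refl with apps-con-injective {a} {i} {ts} {a′} {i′} {ts′} L≡L′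
  ...   | refl , refl = refl
  ⟶-deterministic (ιrec {a} {i} {ts} _ _ _) (ιrec {a′} {i′} {ts′} _ _ _) eq
    with rec-injective eq
  ... | L≡L′ , refl with apps-con-injective {a} {i} {ts} {a′} {i′} {ts′} L≡L′
  ...   | refl , refl = refl
  ⟶-deterministic (β _)         (ιcase _ _ _) ()
  ⟶-deterministic (β _)         (ιrec _ _ _)  ()
  ⟶-deterministic (ιcase _ _ _) (β _)         ()
  ⟶-deterministic (ιcase _ _ _) (ιrec _ _ _)  ()
  ⟶-deterministic (ιrec _ _ _)  (β _)         ()
  ⟶-deterministic (ιrec _ _ _)  (ιcase _ _ _) ()

  β-function-irreducible : ∀ {M L N M′} → app M L ⟶ N → ¬ (M ⇝ M′)
  β-function-irreducible (β _) = value-irreducible (vlam _)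

  β-argument-irreducible : ∀ {M L N M′} → app L M ⟶ N → ¬ (M ⇝ M′)
  β-argument-irreducible (β V) = value-irreducible V

  ι-scrutinee-IsT : ∀ {a i ts} → All FreeAlgTerm ts → IsT (apps (con a i) ts)
  ι-scrutinee-IsT {a} {i} {ts} ts∈ℰ = apps-IsT ts (tcon a i) (All.map (FAT⇒IsT ∘ proj₂) ts∈ℰ)

  case-scrutinee-irreducible : ∀ {M Ms N M′} → case M Ms ⟶ N → ¬ (M ⇝ M′)
  case-scrutinee-irreducible (ιcase _ ts∈ℰ _) = IsT-irreducible (ι-scrutinee-IsT ts∈ℰ)

  rec-scrutinee-irreducible : ∀ {M Ms N M′} → rec M Ms ⟶ N → ¬ (M ⇝ M′)
  rec-scrutinee-irreducible (ιrec _ ts∈ℰ _) = IsT-irreducible (ι-scrutinee-IsT ts∈ℰ)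

  OneStepJoinable : Term → Term → Set
  OneStepJoinable N₁ N₂ = N₁ ≡ N₂ ⊎ ∃ λ P → N₁ ⇝ P × N₂ ⇝ P

  OneStepJoinable-map : ∀ (f : Term → Term) → (∀ {M N} → M ⇝ N → f M ⇝ f N) →
                        ∀ {N₁ N₂} → OneStepJoinable N₁ N₂ → OneStepJoinable (f N₁) (f N₂)
  OneStepJoinable-map f f-mono (inj₁ refl)          = inj₁ refl
  OneStepJoinable-map f f-mono (inj₂ (P , s₁ , s₂)) = inj₂ (f P , f-mono s₁ , f-mono s₂)

  ⇝-diamond : ∀ {M N₁ N₂} → M ⇝ N₁ → M ⇝ N₂ → OneStepJoinable N₁ N₂
  ⇝-diamond (top r₁)   (top r₂)   = inj₁ (⟶-deterministic r₁ r₂ refl)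
  ⇝-diamond (top r)    (appL s)   = ⊥-elim (β-function-irreducible r s)
  ⇝-diamond (top r)    (appR s)   = ⊥-elim (β-argument-irreducible r s)
  ⇝-diamond (top r)    (caseL s)  = ⊥-elim (case-scrutinee-irreducible r s)
  ⇝-diamond (top r)    (recL s)   = ⊥-elim (rec-scrutinee-irreducible r s)
  ⇝-diamond (appL s)   (top r)    = ⊥-elim (β-function-irreducible r s)
  ⇝-diamond (appR s)   (top r)    = ⊥-elim (β-argument-irreducible r s)
  ⇝-diamond (caseL s)  (top r)    = ⊥-elim (case-scrutinee-irreducible r s)
  ⇝-diamond (recL s)   (top r)    = ⊥-elim (rec-scrutinee-irreducible r s)
  ⇝-diamond (appL s₁)  (appL s₂)  = OneStepJoinable-map (λ M → app M _) appL (⇝-diamond s₁ s₂)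
  ⇝-diamond (appR s₁)  (appR s₂)  = OneStepJoinable-map (app _) appR (⇝-diamond s₁ s₂)
  ⇝-diamond (appL s₁)  (appR s₂)  = inj₂ (_ , appR s₂ , appL s₁)
  ⇝-diamond (appR s₁)  (appL s₂)  = inj₂ (_ , appL s₂ , appR s₁)
  ⇝-diamond (caseL s₁) (caseL s₂) = OneStepJoinable-map (λ M → case M _) caseL (⇝-diamond s₁ s₂)
  ⇝-diamond (recL s₁)  (recL s₂)  = OneStepJoinable-map (λ M → rec M _) recL (⇝-diamond s₁ s₂)

  reduct-reaches-normal-form : ∀ {M M′ N} → M ⇝* N → Normal N → M ⇝ M′ → M′ ⇝* N
  reduct-reaches-normal-form ε N-normal s = ⊥-elim (N-normal (_ , s))
  reduct-reaches-normal-form (s₁ ◅ M₁⇝*N) N-normal s with ⇝-diamond s₁ s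
  ... | inj₁ refl              = M₁⇝*N
  ... | inj₂ (P , M₁⇝P , M′⇝P) = M′⇝P ◅ reduct-reaches-normal-form M₁⇝*N N-normal M₁⇝P

  normal-form-unique : ∀ {M N N′} → M ⇝* N → Normal N → M ⇝* N′ → Normal N′ → N′ ≡ N
  normal-form-unique ε       _        ε            _         = refl
  normal-form-unique (s ◅ _) _        ε            N′-normal = ⊥-elim (N′-normal (_ , s))
  normal-form-unique M⇝*N    N-normal (s ◅ M′⇝*N′) N′-normal =
    normal-form-unique (reduct-reaches-normal-form M⇝*N N-normal s) N-normal M′⇝*N′ N′-normal

open WeakNormalisation using (closed-normalises; FAT-normal; normal-form-unique)

proposition1 : (S : Signature) → let open Lang S in
    (M : Term) (n : ℕ) (a : Fin (Signature.nAlg S)) → [] ⊢ M ∶ base a n →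
    Σ Term λ t → UniqueNormalForm M t × FreeAlgTerm t
proposition1 S M n a ⊢M =
  let (t , M⇝*t , t∈𝔸) = closed-normalises S ⊢M
      t-normal         = FAT-normal S t∈𝔸
  in  t , (M⇝*t , t-normal , λ _ M⇝*N′ → normal-form-unique S M⇝*t t-normal M⇝*N′) , (a , t∈𝔸)
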